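{- Let $A$ be a finite set of atoms. Two propositional Horn theories $P$ and $R$ over $A$ are subsumption equivalent (i.e. $T_P=T_R$) if and only if $P\circ I=R\circ I$ for every interpretation $I\subseteq A$. Moreover, subsumption equivalence is a congruence with respect to sequential composition: if $P$ and $R$ are subsumption equivalent, then $Q\circ P\circ S$ and $Q\circ R\circ S$ are subsumption equivalent for all theories $Q,S$ over $A$.
   Context: A theory over $A$ is a finite set of rules $a_0\leftarrow a_1,\ldots,a_k$ ($k\ge0$, $a_i\in A$), with $head(r)=\{a_0\}$, $body(r)=\{a_1,\ldots,a_k\}$, size $k$; $head(S),body(S)$ are unions over a set $S$ of rules. Interpretations (subsets of $A$) are identified with theories consisting of facts (rules with empty body). Write $S\subseteq_r R$ if $S\subseteq R$ has as many elements as the size of $r$. Composition: $P\circ R=\{head(r)\leftarrow body(S)\mid r\in P,\ S\subseteq_r R,\ head(S)=body(r)\}$ (it is associative). The van Emden–Kowalski operator is $T_P(I)=\bigcup\{head(r)\mid r\in P,\ body(r)\subseteq I\}$. -}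

module Defs where

open import Data.Nat using (ℕ)
open import Data.Fin using (Fin)
open import Data.Fin.Subset using (Subset; ⊥; ⁅_⁆; _∪_; _⊆_; ∣_∣) renaming (_∈_ to _∈ₛ_)
open import Data.List using (List; []; _∷_; foldr; length)
open import Data.List.Relation.Unary.All using (All)
open import Data.List.Relation.Unary.Unique.Propositional using (Unique)
open import Data.Product using (Σ; ∃; _×_; _,_; proj₁; proj₂)
open import Relation.Binary.PropositionalEquality using (_≡_)
open import Function.Bundles using (_⇔_)

-- Atoms: the finite set A = Fin n.
-- A rule  a₀ ← a₁,…,aₖ  is a head atom together with its body (a set of atoms).
record Rule (n : ℕ) : Set where
  constructor _←_
  field
    hd : Fin n
    bd : Subset n
open Rule public

size : ∀ {n} → Rule n → ℕ
size r = ∣ bd r ∣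

-- A theory is a set of rules over A.  Since Rule n is a finite type,
-- every such set is finite.  Sets are given by membership predicates.
Theory : ℕ → Set₁
Theory n = Rule n → Set

_≐_ : ∀ {n} → Theory n → Theory n → Set
P ≐ R = ∀ r → P r ⇔ R r

heads : ∀ {n} → List (Rule n) → Subset n
heads = foldr (λ s acc → ⁅ hd s ⁆ ∪ acc) ⊥

bodies : ∀ {n} → List (Rule n) → Subset n
bodies = foldr (λ s acc → bd s ∪ acc) ⊥

-- S ⊆_r R : S is a finite subset of R (duplicate-free list of members of R)
-- with exactly size(r) elements.
_⊆[_]_ : ∀ {n} → List (Rule n) → Rule n → Theory n → Set
S ⊆[ r ] R = Unique S × All R S × length S ≡ size r

-- Sequential composition
-- P ∘ R = { head(r) ← body(S) | r ∈ P, S ⊆_r R, head(S) = body(r) }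
_∘ₜ_ : ∀ {n} → Theory n → Theory n → Theory n
(P ∘ₜ R) x = Σ (Rule _) λ r → P r × Σ (List (Rule _)) λ S →
  S ⊆[ r ] R × heads S ≡ bd r × x ≡ (hd r ← bodies S)

infixl 7 _∘ₜ_

-- An interpretation I ⊆ A, identified with the theory of facts {a ← | a ∈ I}
facts : ∀ {n} → Subset n → Theory n
facts I r = bd r ≡ ⊥ × hd r ∈ₛ I

-- van Emden–Kowalski operator  T_P(I) = ⋃ {head(r) | r ∈ P, body(r) ⊆ I}, as a predicate on atoms
T : ∀ {n} → Theory n → Subset n → Fin n → Set
T P I a = Σ (Rule _) λ r → P r × bd r ⊆ I × hd r ≡ a

SubsEquiv : ∀ {n} → Theory n → Theory n → Set
SubsEquiv P R = ∀ I a → T P I a ⇔ T R I a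

-- T_P extends from interpretations to arbitrary predicates J on atoms, and
-- T_{Q ∘ P}(J) = T_Q(T_P(J)): a rule of Q ∘ P is a rule r of Q whose body
-- atoms are each produced by a rule of P, and conversely such a choice of
-- P-rules for the body of r yields a member of Q ∘ P.  Composition is
-- therefore monotone for the pointwise order of T-operators, which gives the
-- congruence.  Composing with facts I computes T_P(I) as a set of facts, so
-- P ∘ I = R ∘ I for all I says exactly that T_P = T_R.
module Submission where

open import Defs
open import Data.Nat using (ℕ; suc)
open import Data.Fin using (Fin; zero; suc)
open import Data.Fin.Properties using (suc-injective)
open import Data.Fin.Subset using (Subset; ⊥; ⁅_⁆; _∪_; _∈_; _⊆_; ∣_∣; inside; outside)
open import Data.Fin.Subset.Properties using (∪-identityˡ; x∈p∪q⁻; p⊆p∪q; q⊆p∪q; ∉⊥; x∈⁅y⁆⇒x≡y)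
open import Data.Vec using ([]; _∷_; here; there)
open import Data.List using (List; []; _∷_; map; foldr; length)
open import Data.List.Properties using (length-map)
open import Data.List.Membership.Propositional using () renaming (_∈_ to _∈ˡ_)
open import Data.List.Relation.Unary.Any using (here; there)
open import Data.List.Relation.Unary.All as All using (All; []; _∷_)
open import Data.List.Relation.Unary.All.Properties using (map⁺)
open import Data.List.Relation.Unary.AllPairs using ([]; _∷_)
open import Data.List.Relation.Unary.Unique.Propositional using (Unique)
import Data.List.Relation.Unary.Unique.Propositional.Properties as Unique
open import Data.Product using (Σ; ∃; _×_; _,_; proj₁; proj₂)
open import Data.Product.Function.NonDependent.Propositional using (_×-⇔_)
open import Data.Sum using (inj₁; inj₂)
open import Data.Unit using (⊤; tt)
open import Relation.Binary.PropositionalEquality using (_≡_; refl; sym; trans; cong; cong₂; subst; module ≡-Reasoning)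
open import Relation.Nullary using (contradiction)
open import Function using (_∘_)
open import Function.Bundles using (_⇔_; mk⇔; Equivalence)
open import Function.Construct.Identity using (⇔-id)
open import Function.Construct.Symmetry using (⇔-sym)
open import Function.Construct.Composition using (_⇔-∘_)
open Equivalence using (to; from)

private variable
  n : ℕ
  a b : Fin n
  r x : Rule n
  S : List (Rule n)
  P Q R : Theory n
  I : Subset n
  J K : Fin n → Set

elements : Subset n → List (Fin n)
elements []            = []
elements (inside ∷ p)  = zero ∷ map suc (elements p)
elements (outside ∷ p) = map suc (elements p)

fromList : List (Fin n) → Subset n
fromList = foldr (λ a → ⁅ a ⁆ ∪_) ⊥

fromList-map-suc : (L : List (Fin n)) → fromList (map suc L) ≡ outside ∷ fromList L
fromList-map-suc []      = refl
fromList-map-suc (a ∷ L) = cong (⁅ suc a ⁆ ∪_) (fromList-map-suc L)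

fromList-elements : (p : Subset n) → fromList (elements p) ≡ p
fromList-elements [] = refl
fromList-elements (inside ∷ p)
  rewrite fromList-map-suc (elements p) | ∪-identityˡ (fromList (elements p)) =
  cong (inside ∷_) (fromList-elements p)
fromList-elements (outside ∷ p)
  rewrite fromList-map-suc (elements p) = cong (outside ∷_) (fromList-elements p)

length-elements : (p : Subset n) → length (elements p) ≡ ∣ p ∣
length-elements []            = refl
length-elements (inside ∷ p)  = cong suc (trans (length-map suc (elements p)) (length-elements p))
length-elements (outside ∷ p) = trans (length-map suc (elements p)) (length-elements p)

elements⊆ : (p : Subset n) → All (_∈ p) (elements p)
elements⊆ []            = []
elements⊆ (inside ∷ p)  = here ∷ map⁺ (All.map there (elements⊆ p))
elements⊆ (outside ∷ p) = map⁺ (All.map there (elements⊆ p))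

elements-unique : (p : Subset n) → Unique (elements p)
elements-unique []            = []
elements-unique (inside ∷ p)  =
  map⁺ (All.tabulate (λ _ ())) ∷ Unique.map⁺ suc-injective (elements-unique p)
elements-unique (outside ∷ p) = Unique.map⁺ suc-injective (elements-unique p)

heads≡fromList : (S : List (Rule n)) → heads S ≡ fromList (map hd S)
heads≡fromList []      = refl
heads≡fromList (s ∷ S) = cong (⁅ hd s ⁆ ∪_) (heads≡fromList S)

∈-heads⁻ : (S : List (Rule n)) → b ∈ heads S → ∃ λ s → s ∈ˡ S × hd s ≡ b
∈-heads⁻ []      b∈ = contradiction b∈ ∉⊥
∈-heads⁻ (s ∷ S) b∈ with x∈p∪q⁻ ⁅ hd s ⁆ (heads S) b∈
... | inj₁ b∈⁅hd⁆ = s , here refl , sym (x∈⁅y⁆⇒x≡y (hd s) b∈⁅hd⁆)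
... | inj₂ b∈hds  = let s′ , s′∈ , eq = ∈-heads⁻ S b∈hds in s′ , there s′∈ , eq

∈-bodies⁻ : (S : List (Rule n)) → b ∈ bodies S → ∃ λ s → s ∈ˡ S × b ∈ bd s
∈-bodies⁻ []      b∈ = contradiction b∈ ∉⊥
∈-bodies⁻ (s ∷ S) b∈ with x∈p∪q⁻ (bd s) (bodies S) b∈
... | inj₁ b∈bd  = s , here refl , b∈bd
... | inj₂ b∈bds = let s′ , s′∈ , b∈′ = ∈-bodies⁻ S b∈bds in s′ , there s′∈ , b∈′

bd⊆bodies : {s : Rule n} → s ∈ˡ S → bd s ⊆ bodies S
bd⊆bodies {S = s ∷ S} (here refl) = p⊆p∪q (bodies S)
bd⊆bodies {S = s ∷ S} (there s∈)  = q⊆p∪q (bd s) (bodies S) ∘ bd⊆bodies s∈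

bodies-⊥ : All (λ s → bd s ≡ ⊥) S → bodies S ≡ ⊥
bodies-⊥ []                    = refl
bodies-⊥ {S = s ∷ S} (e ∷ es) rewrite e | bodies-⊥ es = ∪-identityˡ ⊥

HeadOf : Theory n → Fin n → Set
HeadOf X b = ∃ λ s → X s × hd s ≡ b

module _ {X : Theory n} where

  pick : {L : List (Fin n)} → All (HeadOf X) L → List (Rule n)
  pick []             = []
  pick ((s , _) ∷ cs) = s ∷ pick cs

  map-hd-pick : {L : List (Fin n)} (cs : All (HeadOf X) L) → map hd (pick cs) ≡ L
  map-hd-pick []                 = refl
  map-hd-pick ((_ , _ , e) ∷ cs) = cong₂ _∷_ e (map-hd-pick cs)

  pick⊆ : {L : List (Fin n)} (cs : All (HeadOf X) L) → All X (pick cs)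
  pick⊆ []                  = []
  pick⊆ ((_ , Xs , _) ∷ cs) = Xs ∷ pick⊆ cs

  -- The chosen heads are the listed (hence distinct) body atoms of r, so the
  -- chosen rules are distinct and there are exactly size r of them.
  choose-support : (∀ {b} → b ∈ bd r → HeadOf X b) →
                   ∃ λ S → S ⊆[ r ] X × heads S ≡ bd r
  choose-support {r = r} choice =
    chosen , (unique , pick⊆ cs , size-chosen) , heads-chosen
    where
    cs = All.map choice (elements⊆ (bd r))
    chosen = pick cs

    unique : Unique chosen
    unique = Unique.map⁻ (subst Unique (sym (map-hd-pick cs)) (elements-unique (bd r)))

    size-chosen : length chosen ≡ size r
    size-chosen = begin
      length chosen            ≡⟨ sym (length-map hd chosen) ⟩
      length (map hd chosen)   ≡⟨ cong length (map-hd-pick cs) ⟩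
      length (elements (bd r)) ≡⟨ length-elements (bd r) ⟩
      size r                   ∎
      where open ≡-Reasoning

    heads-chosen : heads chosen ≡ bd r
    heads-chosen = begin
      heads chosen               ≡⟨ heads≡fromList chosen ⟩
      fromList (map hd chosen)   ≡⟨ cong fromList (map-hd-pick cs) ⟩
      fromList (elements (bd r)) ≡⟨ fromList-elements (bd r) ⟩
      bd r                       ∎
      where open ≡-Reasoning

-- T_P with the interpretation given as a predicate: T_R(I) need not be a
-- Subset, but T_Q can still be applied to it.  T P I is T′ P (_∈ I) by
-- definition.
T′ : Theory n → (Fin n → Set) → Fin n → Set
T′ P J a = Σ (Rule _) λ r → P r × (∀ {b} → b ∈ bd r → J b) × hd r ≡ a

T′-mono : (∀ {b} → J b → K b) → T′ P J a → T′ P K a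
T′-mono J⊆K (r , Pr , bd⊆J , eq) = r , Pr , J⊆K ∘ bd⊆J , eq

T′-∘ : T′ (Q ∘ₜ P) J a ⇔ T′ Q (T′ P J) a
T′-∘ {Q = Q} {P = P} {J = J} = mk⇔ split join
  where
  split : T′ (Q ∘ₜ P) J a → T′ Q (T′ P J) a
  split (_ , (r , Qr , S , (_ , PS , _) , hS , refl) , bodies⊆J , eq) = r , Qr , produced , eq
    where
    produced : ∀ {b} → b ∈ bd r → T′ P J b
    produced b∈ with ∈-heads⁻ S (subst (_ ∈_) (sym hS) b∈)
    ... | s , s∈S , hs≡b = s , All.lookup PS s∈S , bodies⊆J ∘ bd⊆bodies s∈S , hs≡b

  join : T′ Q (T′ P J) a → T′ (Q ∘ₜ P) J a
  join (r , Qr , produced , eq)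
    with choose-support {X = λ s → P s × (∀ {c} → c ∈ bd s → J c)} {r = r}
           (λ b∈ → let s , Ps , bd⊆J , hs≡b = produced b∈ in s , (Ps , bd⊆J) , hs≡b)
  ... | S , (u , PS , size-S) , hS =
    (hd r ← bodies S) , (r , Qr , S , (u , All.map proj₁ PS , size-S) , hS , refl) ,
    bodies⊆J , eq
    where
    bodies⊆J : ∀ {b} → b ∈ bodies S → J b
    bodies⊆J b∈ with ∈-bodies⁻ S b∈
    ... | s , s∈S , b∈s = proj₂ (All.lookup PS s∈S) b∈s

T′-facts : T′ (facts I) J b ⇔ b ∈ I
T′-facts {b = b} = mk⇔ (λ { (_ , (_ , hd∈I) , _ , refl) → hd∈I })
                      (λ b∈I → (b ← ⊥) , (refl , b∈I) , (λ {_} b∈⊥ → contradiction b∈⊥ ∉⊥) , refl)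

∘facts-bd : (P ∘ₜ facts I) x → bd x ≡ ⊥
∘facts-bd (_ , _ , _ , (_ , factsS , _) , _ , refl) = bodies-⊥ (All.map proj₁ factsS)

∘-facts : (P ∘ₜ facts I) x ⇔ (bd x ≡ ⊥ × T P I (hd x))
∘-facts {P = P} {I = I} {x = x} = mk⇔ forward backward
  where
  forward : (P ∘ₜ facts I) x → bd x ≡ ⊥ × T P I (hd x)
  forward x∈ = ∘facts-bd x∈ ,
    T′-mono (to T′-facts) (to (T′-∘ {J = λ _ → ⊤}) (x , x∈ , (λ _ → tt) , refl))

  backward : bd x ≡ ⊥ × T P I (hd x) → (P ∘ₜ facts I) x
  backward (bd≡⊥ , t) with from (T′-∘ {J = λ _ → ⊤}) (T′-mono (from T′-facts) t)
  ... | y , y∈ , _ , hd≡ =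
    subst (P ∘ₜ facts I) (cong₂ _←_ hd≡ (trans (∘facts-bd y∈) (sym bd≡⊥))) y∈

T⇔∘facts : T P I a ⇔ (P ∘ₜ facts I) (a ← ⊥)
T⇔∘facts = ⇔-sym ∘-facts ⇔-∘ mk⇔ (refl ,_) proj₂

SubsEquiv⇒∘facts-≐ : SubsEquiv P R → ∀ I → (P ∘ₜ facts I) ≐ (R ∘ₜ facts I)
SubsEquiv⇒∘facts-≐ P≈R I x = ⇔-sym ∘-facts ⇔-∘ ((⇔-id _ ×-⇔ P≈R I (hd x)) ⇔-∘ ∘-facts)

∘facts-≐⇒SubsEquiv : (∀ I → (P ∘ₜ facts I) ≐ (R ∘ₜ facts I)) → SubsEquiv P R
∘facts-≐⇒SubsEquiv P∘I≐R∘I I a = ⇔-sym T⇔∘facts ⇔-∘ (P∘I≐R∘I I (a ← ⊥) ⇔-∘ T⇔∘facts)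

_⊑_ : Theory n → Theory n → Set
P ⊑ R = ∀ I a → T P I a → T R I a

T′-⊑ : P ⊑ R → T′ P J a → T′ R J a
T′-⊑ P⊑R (r , Pr , bd⊆J , eq) with P⊑R (bd r) _ (r , Pr , (λ b∈ → b∈) , eq)
... | r′ , Rr′ , bd′⊆bd , eq′ = r′ , Rr′ , bd⊆J ∘ bd′⊆bd , eq′

∘-monoʳ-⊑ : P ⊑ R → (Q ∘ₜ P) ⊑ (Q ∘ₜ R)
∘-monoʳ-⊑ P⊑R I a = from T′-∘ ∘ T′-mono (T′-⊑ P⊑R) ∘ to T′-∘

∘-monoˡ-⊑ : P ⊑ R → (P ∘ₜ Q) ⊑ (R ∘ₜ Q)
∘-monoˡ-⊑ P⊑R I a = from T′-∘ ∘ T′-⊑ P⊑R ∘ to T′-∘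

SubsEquiv-∘-cong : SubsEquiv P R → ∀ Q S → SubsEquiv (Q ∘ₜ P ∘ₜ S) (Q ∘ₜ R ∘ₜ S)
SubsEquiv-∘-cong P≈R Q S I a = mk⇔
  (∘-monoˡ-⊑ (∘-monoʳ-⊑ (λ I a → to (P≈R I a))) I a)
  (∘-monoˡ-⊑ (∘-monoʳ-⊑ (λ I a → from (P≈R I a))) I a)

corollary6p5 : (n : ℕ) (P R : Theory n) →
    (SubsEquiv P R ⇔ (∀ (I : Subset n) → (P ∘ₜ facts I) ≐ (R ∘ₜ facts I)))
    × (SubsEquiv P R → ∀ (Q S : Theory n) → SubsEquiv (Q ∘ₜ P ∘ₜ S) (Q ∘ₜ R ∘ₜ S))
corollary6p5 n P R = mk⇔ SubsEquiv⇒∘facts-≐ ∘facts-≐⇒SubsEquiv , SubsEquiv-∘-cong
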